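{- Let $m\ge 4$ and let $n\ge 5$ be odd. Then the radio number of the stacked-book graph $G_{m,n}=S_m\Box P_n$ satisfies $$rn(G_{m,n})\ge \frac{mn^2+m+2n-4}{2}.$$
   Context: $S_m$ is the star on $m$ vertices (one center adjacent to $m-1$ leaves) and $P_n$ is the path on $n$ vertices. The stacked-book graph $G_{m,n}=S_m\Box P_n$ is their Cartesian product, with vertex set $V(S_m)\times V(P_n)$; two vertices $(a,i),(b,j)$ are adjacent iff either $a=b$ and $ij\in E(P_n)$, or $i=j$ and $ab\in E(S_m)$. For a connected graph $G$ with diameter $\mathrm{diam}(G)$ and distance $d$, a radio labeling is a function $f:V(G)\to\mathbb{Z}_{\ge 0}$ with $|f(u)-f(v)|\ge \mathrm{diam}(G)+1-d(u,v)$ for all distinct $u,v\in V(G)$; its span is $\max f-\min f$, and the radio number $rn(G)$ is the minimum span over all radio labelings of $G$. -}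

module Defs where

open import Data.Nat using (ℕ; zero; suc; _+_; _∸_; _≤_; _⊔_; _⊓_; ∣_-_∣)
open import Data.Fin using (Fin; toℕ)
open import Data.Product using (_×_; _,_; ∃; ∃-syntax)
open import Data.Sum using (_⊎_)
open import Data.List using (List; map; foldr; allFin; cartesianProduct)
open import Relation.Binary.PropositionalEquality using (_≡_; _≢_)
open import Relation.Nullary using (¬_)

-- Star S_m on vertex set Fin m, centre = zero, leaves = the other m-1 vertices.
StarAdj : {m : ℕ} → Fin m → Fin m → Set
StarAdj a b = (toℕ a ≡ 0 × ¬ (toℕ b ≡ 0)) ⊎ (toℕ b ≡ 0 × ¬ (toℕ a ≡ 0))

PathAdj : {n : ℕ} → Fin n → Fin n → Set
PathAdj i j = (suc (toℕ i) ≡ toℕ j) ⊎ (suc (toℕ j) ≡ toℕ i)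

Vtx : ℕ → ℕ → Set
Vtx m n = Fin m × Fin n

BookAdj : (m n : ℕ) → Vtx m n → Vtx m n → Set
BookAdj m n (a , i) (b , j) = (a ≡ b × PathAdj i j) ⊎ (i ≡ j × StarAdj a b)

data Walk {V : Set} (Adj : V → V → Set) : V → V → ℕ → Set where
  nil  : ∀ {u} → Walk Adj u u 0
  cons : ∀ {u v w k} → Adj u v → Walk Adj v w k → Walk Adj u w (suc k)

IsDist : {V : Set} → (V → V → Set) → V → V → ℕ → Set
IsDist Adj u v k = Walk Adj u v k × (∀ l → Walk Adj u v l → k ≤ l)

IsDiam : {V : Set} → (V → V → Set) → ℕ → Set
IsDiam {V} Adj D = (∀ u v → ∃[ k ] (IsDist Adj u v k × k ≤ D))
                 × (∃[ u ] ∃[ v ] IsDist Adj u v D)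

IsRadio : {V : Set} → (V → V → Set) → ℕ → (V → ℕ) → Set
IsRadio {V} Adj D f = ∀ (u v : V) → u ≢ v → ∀ k → IsDist Adj u v k →
                      suc D ∸ k ≤ ∣ f u - f v ∣

vertices : (m n : ℕ) → List (Vtx m n)
vertices m n = cartesianProduct (allFin m) (allFin n)

maxLabel : (m n : ℕ) → (Vtx m n → ℕ) → ℕ
maxLabel m n f = foldr _⊔_ 0 (map f (vertices m n))

-- min over the vertices (the max is an upper bound for every label, so it is a safe seed)
minLabel : (m n : ℕ) → (Vtx m n → ℕ) → ℕ
minLabel m n f = foldr _⊓_ (maxLabel m n f) (map f (vertices m n))

span : (m n : ℕ) → (Vtx m n → ℕ) → ℕ
span m n f = maxLabel m n f ∸ minLabel m n f

{-# OPTIONS --safe #-}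
-- Put n = 2k + 1 and let L v be the length of the obvious walk from v to the centre of the
-- middle star, so that d(u, v) ≤ L u + L v; the diameter is at least n + 1. Listing the mn
-- vertices by increasing label, the radio condition makes consecutive labels differ by at
-- least diam + 1 − L u − L v. Summing over the mn − 1 consecutive pairs counts each L v at
-- most twice, so span ≥ (mn − 1)(n + 2) − 2 Σ L, and Σ L = (m − 1) n + m k (k + 1).
module Submission where

open import Defs
open import Data.Nat
open import Data.Nat.Properties
open import Data.Nat.DivMod using (m≡m%n+[m/n]*n)
open import Data.Nat.ListAction using (sum)
open import Data.Nat.ListAction.Properties using (sum-++; sum-↭)
open import Data.Nat.Tactic.RingSolver using (solve-∀; solve)
open import Data.Fin using (Fin; zero; suc; toℕ; fromℕ; fromℕ<)
open import Data.Fin.Properties using (toℕ-injective; toℕ<n; toℕ-fromℕ; toℕ-fromℕ<)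
open import Data.List using (List; []; _∷_; _++_; map; foldr; length; tabulate; allFin; upTo; applyUpTo; cartesianProduct)
open import Data.List.Properties using (map-++; map-∘; map-cong; map-tabulate; map-upTo; applyUpTo-∷ʳ; length-++; length-map; length-tabulate)
open import Data.List.Membership.Propositional using (_∈_)
open import Data.List.Membership.Propositional.Properties using (∈-map⁺)
open import Data.List.Relation.Unary.Any using (here; there)
import Data.List.Relation.Unary.All as All
import Data.List.Relation.Unary.AllPairs as AllPairs
open import Data.List.Relation.Unary.Linked as Linked using (Linked)
open import Data.List.Relation.Unary.Unique.Propositional using (Unique)
open import Data.List.Relation.Unary.Unique.Propositional.Properties using (cartesianProduct⁺; allFin⁺)
open import Data.List.Relation.Binary.Permutation.Propositional using (↭-sym; ↭⇒↭ₛ)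
open import Data.List.Relation.Binary.Permutation.Propositional.Properties using (∈-resp-↭; ↭-length; map⁺)
import Data.List.Relation.Binary.Permutation.Setoid.Properties as Permutationₛ
import Data.List.Sort as Sort
import Relation.Binary.Construct.On as On
open import Data.Product using (_×_; _,_; ∃-syntax)
open import Data.Sum using (inj₁; inj₂)
open import Function using (_∘_)
open import Relation.Binary.PropositionalEquality
open import Algebra.Properties.CommutativeSemigroup +-commutativeSemigroup using (x∙yz≈y∙xz)
∈⇒≤foldr-⊔ : ∀ {c xs} → c ∈ xs → c ≤ foldr _⊔_ 0 xs
∈⇒≤foldr-⊔ {xs = x ∷ _} (here refl)  = m≤m⊔n x _
∈⇒≤foldr-⊔ {xs = x ∷ _} (there c∈xs) = ≤-trans (∈⇒≤foldr-⊔ c∈xs) (m≤n⊔m x _)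

∈⇒foldr-⊓≤ : ∀ e {c xs} → c ∈ xs → foldr _⊓_ e xs ≤ c
∈⇒foldr-⊓≤ e {xs = x ∷ _} (here refl)  = m⊓n≤m x _
∈⇒foldr-⊓≤ e {xs = x ∷ _} (there c∈xs) = ≤-trans (m⊓n≤n x _) (∈⇒foldr-⊓≤ e c∈xs)

module _ {A : Set} where

  sum-map-const : ∀ c (xs : List A) → sum (map (λ _ → c) xs) ≡ length xs * c
  sum-map-const c []       = refl
  sum-map-const c (_ ∷ xs) = cong (c +_) (sum-map-const c xs)

  sum-map-suc : ∀ (g : A → ℕ) xs → sum (map (suc ∘ g) xs) ≡ length xs + sum (map g xs)
  sum-map-suc g []       = refl
  sum-map-suc g (x ∷ xs) =
    cong suc (trans (cong (g x +_) (sum-map-suc g xs)) (x∙yz≈y∙xz (g x) (length xs) _))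

  map-allFin-suc : ∀ {n} (g : Fin (suc n) → A) → map g (allFin (suc n)) ≡ g zero ∷ map (g ∘ suc) (allFin n)
  map-allFin-suc g = trans (map-tabulate (λ i → i) g) (cong (g zero ∷_) (sym (map-tabulate (λ i → i) (g ∘ suc))))

module _ {A B : Set} where

  sum-map-cartesianProduct : ∀ (g : A × B → ℕ) xs ys →
    sum (map g (cartesianProduct xs ys)) ≡ sum (map (λ x → sum (map (λ y → g (x , y)) ys)) xs)
  sum-map-cartesianProduct g []       ys = refl
  sum-map-cartesianProduct g (x ∷ xs) ys = begin
    sum (map g (map (x ,_) ys ++ cartesianProduct xs ys))
      ≡⟨ cong sum (map-++ g (map (x ,_) ys) (cartesianProduct xs ys)) ⟩
    sum (map g (map (x ,_) ys) ++ map g (cartesianProduct xs ys))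
      ≡⟨ sum-++ (map g (map (x ,_) ys)) _ ⟩
    sum (map g (map (x ,_) ys)) + sum (map g (cartesianProduct xs ys))
      ≡⟨ cong₂ _+_ (cong sum (sym (map-∘ ys))) (sum-map-cartesianProduct g xs ys) ⟩
    sum (map (λ y → g (x , y)) ys) + sum (map (λ x → sum (map (λ y → g (x , y)) ys)) xs) ∎
    where open ≡-Reasoning

  length-cartesianProduct : ∀ (xs : List A) (ys : List B) →
    length (cartesianProduct xs ys) ≡ length xs * length ys
  length-cartesianProduct []       ys = refl
  length-cartesianProduct (x ∷ xs) ys = begin
    length (map (x ,_) ys ++ cartesianProduct xs ys)       ≡⟨ length-++ (map (x ,_) ys) ⟩
    length (map (x ,_) ys) + length (cartesianProduct xs ys) ≡⟨ cong₂ _+_ (length-map (x ,_) ys) (length-cartesianProduct xs ys) ⟩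
    length ys + length xs * length ys                        ∎
    where open ≡-Reasoning

length-allFin : ∀ n → length (allFin n) ≡ n
length-allFin n = length-tabulate (λ i → i)

map-toℕ-allFin : ∀ n → map toℕ (allFin n) ≡ upTo n
map-toℕ-allFin zero    = refl
map-toℕ-allFin (suc n) = cong (0 ∷_) (begin
  map toℕ (tabulate suc)          ≡⟨ map-tabulate suc toℕ ⟩
  tabulate (suc ∘ toℕ)            ≡⟨ sym (map-tabulate toℕ suc) ⟩
  map suc (tabulate toℕ)          ≡⟨ cong (map suc) (sym (map-tabulate (λ i → i) toℕ)) ⟩
  map suc (map toℕ (allFin n))    ≡⟨ cong (map suc) (map-toℕ-allFin n) ⟩
  map suc (upTo n)                ≡⟨ map-upTo suc n ⟩
  applyUpTo suc n                 ∎)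
  where open ≡-Reasoning

sum-map-allFin-toℕ : ∀ (g : ℕ → ℕ) n → sum (map (g ∘ toℕ) (allFin n)) ≡ sum (applyUpTo g n)
sum-map-allFin-toℕ g n = cong sum (begin
  map (g ∘ toℕ) (allFin n)     ≡⟨ map-∘ (allFin n) ⟩
  map g (map toℕ (allFin n))   ≡⟨ cong (map g) (map-toℕ-allFin n) ⟩
  map g (upTo n)               ≡⟨ map-upTo g n ⟩
  applyUpTo g n                ∎)
  where open ≡-Reasoning

sum-applyUpTo-suc : ∀ (g : ℕ → ℕ) n → sum (applyUpTo g (suc n)) ≡ sum (applyUpTo g n) + g n
sum-applyUpTo-suc g n = begin
  sum (applyUpTo g (suc n))               ≡⟨ cong sum (sym (applyUpTo-∷ʳ g n)) ⟩
  sum (applyUpTo g n ++ g n ∷ [])         ≡⟨ sum-++ (applyUpTo g n) (g n ∷ []) ⟩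
  sum (applyUpTo g n) + (g n + 0)         ≡⟨ cong (sum (applyUpTo g n) +_) (+-identityʳ (g n)) ⟩
  sum (applyUpTo g n) + g n               ∎
  where open ≡-Reasoning

sum-∣i-k∣-below-2k+1 : ∀ k → sum (applyUpTo (λ i → ∣ i - k ∣) (suc (k * 2))) ≡ k * suc k
sum-∣i-k∣-below-2k+1 zero    = refl
sum-∣i-k∣-below-2k+1 (suc k) = begin
  suc k + sum (applyUpTo g (suc (suc (k * 2))))          ≡⟨ cong (suc k +_) (sum-applyUpTo-suc g (suc (k * 2))) ⟩
  suc k + (sum (applyUpTo g (suc (k * 2))) + g (suc (k * 2)))
    ≡⟨ cong₂ (λ s t → suc k + (s + t)) (sum-∣i-k∣-below-2k+1 k) ∣2k+1-k∣≡k+1 ⟩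
  suc k + (k * suc k + suc k)                            ≡⟨ solve (k ∷ []) ⟩
  suc k * suc (suc k)                                    ∎
  where
  open ≡-Reasoning
  g : ℕ → ℕ
  g i = ∣ i - k ∣
  ∣2k+1-k∣≡k+1 : ∣ suc (k * 2) - k ∣ ≡ suc k
  ∣2k+1-k∣≡k+1 = begin
    ∣ suc (k * 2) - k ∣   ≡⟨ cong (λ t → ∣ t - k ∣) 2k+1≡[k+1]+k ⟩
    ∣ suc k + k - k ∣     ≡⟨ m≤n⇒∣n-m∣≡n∸m (m≤n+m k (suc k)) ⟩
    suc k + k ∸ k         ≡⟨ m+n∸n≡m (suc k) k ⟩
    suc k                 ∎
    where
    2k+1≡[k+1]+k : suc (k * 2) ≡ suc k + k
    2k+1≡[k+1]+k = solve (k ∷ [])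

m+n≤o+p⇒m≤o∸n+p : ∀ m n o p → m + n ≤ o + p → m ≤ (o ∸ n) + p
m+n≤o+p⇒m≤o∸n+p m n o p m+n≤o+p = +-cancelˡ-≤ n m _ (begin
  n + m              ≡⟨ +-comm n m ⟩
  m + n              ≤⟨ m+n≤o+p ⟩
  o + p              ≤⟨ +-monoˡ-≤ p (m≤n+m∸n o n) ⟩
  n + (o ∸ n) + p    ≡⟨ +-assoc n (o ∸ n) p ⟩
  n + ((o ∸ n) + p)  ∎)
  where open ≤-Reasoning

Gap : {V : Set} → (V → ℕ) → (V → ℕ) → ℕ → Set
Gap f L K = ∀ x y → x ≢ y → f x ≤ f y → K + f x ≤ L x + L y + f y

module _ {V : Set} (f L : V → ℕ) {K : ℕ} (gap : Gap f L K) where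

  sorted-chain : ∀ {x xs} → Linked (λ x y → f x ≤ f y) (x ∷ xs) → Unique (x ∷ xs) →
                 ∃[ z ] z ∈ x ∷ xs × length xs * K + f x + L x ≤ f z + 2 * sum (map L (x ∷ xs))
  sorted-chain {x} {[]} _ _ = x , here refl , (begin
    f x + L x              ≤⟨ m≤m+n (f x + L x) (L x) ⟩
    f x + L x + L x        ≡⟨ a+b+b≡a+2[b+0] (f x) (L x) ⟩
    f x + 2 * (L x + 0)    ∎)
    where
    open ≤-Reasoning
    a+b+b≡a+2[b+0] : ∀ a b → a + b + b ≡ a + 2 * (b + 0)
    a+b+b≡a+2[b+0] = solve-∀
  sorted-chain {x} {y ∷ ys} linked unique with sorted-chain (Linked.tail linked) (AllPairs.tail unique)
  ... | z , z∈ , chain = z , there z∈ , (begin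
    (K + l) + f x + L x               ≡⟨ regroup₁ K l (f x) (L x) ⟩
    l + (K + f x) + L x               ≤⟨ +-monoˡ-≤ (L x) (+-monoʳ-≤ l (gap x y (All.head (AllPairs.head unique)) (Linked.head linked))) ⟩
    l + (L x + L y + f y) + L x       ≡⟨ regroup₂ l (L x) (L y) (f y) ⟩
    (l + f y + L y) + 2 * L x         ≤⟨ +-monoˡ-≤ (2 * L x) chain ⟩
    f z + 2 * Σ + 2 * L x             ≡⟨ regroup₃ (f z) Σ (L x) ⟩
    f z + 2 * (L x + Σ)               ∎)
    where
    open ≤-Reasoning
    l Σ : ℕ
    l = length ys * K
    Σ = sum (map L (y ∷ ys))
    regroup₁ : ∀ a b c d → (a + b) + c + d ≡ b + (a + c) + d
    regroup₁ = solve-∀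
    regroup₂ : ∀ a b c d → a + (b + c + d) + b ≡ (a + d + c) + 2 * b
    regroup₂ = solve-∀
    regroup₃ : ∀ a b c → a + 2 * b + 2 * c ≡ a + 2 * (c + b)
    regroup₃ = solve-∀

  open Sort (On.decTotalOrder ≤-decTotalOrder f) using (sort; sort-↗; sort-↭)

  gap-spread : ∀ e xs → Unique xs →
               (length xs ∸ 1) * K ≤ (foldr _⊔_ 0 (map f xs) ∸ foldr _⊓_ e (map f xs)) + 2 * sum (map L xs)
  gap-spread e xs unique with sort xs | sort-↗ xs | sort-↭ xs
  ... | []     | _      | sorted↭xs rewrite ↭-length (↭-sym sorted↭xs) = z≤n
  ... | x ∷ ys | sorted | sorted↭xs
    with sorted-chain sorted (Permutationₛ.Unique-resp-↭ (setoid V) (↭⇒↭ₛ (↭-sym sorted↭xs)) unique)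
  ... | z , z∈ , chain = begin
    (length xs ∸ 1) * K              ≡⟨ cong (λ l → (l ∸ 1) * K) (↭-length sorted↭xs) ⟨
    length ys * K                    ≤⟨ m+n≤o+p⇒m≤o∸n+p _ (f x) (f z) _ (≤-trans (m≤m+n _ (L x)) chain) ⟩
    (f z ∸ f x) + 2 * Σ              ≤⟨ +-monoˡ-≤ (2 * Σ) (∸-mono (∈⇒≤foldr-⊔ (∈-map⁺ f (∈-resp-↭ sorted↭xs z∈)))
                                                             (∈⇒foldr-⊓≤ e (∈-map⁺ f (∈-resp-↭ sorted↭xs (here refl))))) ⟩
    (max ∸ min) + 2 * Σ              ≡⟨ cong (λ s → (max ∸ min) + 2 * s) (sum-↭ (map⁺ L sorted↭xs)) ⟩
    (max ∸ min) + 2 * sum (map L xs) ∎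
    where
    open ≤-Reasoning
    Σ max min : ℕ
    Σ = sum (map L (x ∷ ys))
    max = foldr _⊔_ 0 (map f xs)
    min = foldr _⊓_ e (map f xs)

module _ {V : Set} {Adj : V → V → Set} where

  _++ʷ_ : ∀ {u v w k l} → Walk Adj u v k → Walk Adj v w l → Walk Adj u w (k + l)
  nil      ++ʷ q = q
  cons a p ++ʷ q = cons a (p ++ʷ q)

  _∷ʳʷ_ : ∀ {u v w k} → Walk Adj u v k → Adj v w → Walk Adj u w (suc k)
  nil      ∷ʳʷ b = cons b nil
  cons a p ∷ʳʷ b = cons a (p ∷ʳʷ b)

  reverseʷ : (∀ {x y} → Adj x y → Adj y x) → ∀ {u v k} → Walk Adj u v k → Walk Adj v u k
  reverseʷ adj-sym nil        = nil
  reverseʷ adj-sym (cons a p) = reverseʷ adj-sym p ∷ʳʷ adj-sym a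

  walk-potential : (φ : V → ℕ) → (∀ {x y} → Adj x y → φ y ≤ suc (φ x)) →
                   ∀ {u v k} → Walk Adj u v k → φ v ≤ φ u + k
  walk-potential φ step {u} nil = m≤m+n (φ u) 0
  walk-potential φ step {u} {v} {suc k} (cons {v = w} a p) = begin
    φ v           ≤⟨ walk-potential φ step p ⟩
    φ w + k       ≤⟨ +-monoˡ-≤ k (step a) ⟩
    suc (φ u) + k ≡⟨ +-suc (φ u) k ⟨
    φ u + suc k   ∎
    where open ≤-Reasoning

radio-gap : ∀ {V : Set} {Adj : V → V → Set} {D f} (L : V → ℕ) → IsDiam Adj D →
            (∀ {u v k} → IsDist Adj u v k → k ≤ L u + L v) →
            IsRadio Adj D f → Gap f L (suc D)
radio-gap {D = D} {f} L (dists , _) dist≤L+L radio x y x≢y fx≤fy with dists x y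
... | k , d , _ = begin
  suc D + f x                     ≤⟨ +-monoˡ-≤ (f x) (m≤n+m∸n (suc D) k) ⟩
  k + (suc D ∸ k) + f x           ≤⟨ +-monoˡ-≤ (f x) (+-mono-≤ (dist≤L+L d) separation) ⟩
  L x + L y + (f y ∸ f x) + f x   ≡⟨ +-assoc (L x + L y) (f y ∸ f x) (f x) ⟩
  L x + L y + (f y ∸ f x + f x)   ≡⟨ cong (L x + L y +_) (m∸n+n≡m fx≤fy) ⟩
  L x + L y + f y                 ∎
  where
  open ≤-Reasoning
  separation : suc D ∸ k ≤ f y ∸ f x
  separation = subst (suc D ∸ k ≤_) (m≤n⇒∣m-n∣≡n∸m fx≤fy) (radio x y x≢y k d)

bookAdj-sym : ∀ {m n} {x y : Vtx m n} → BookAdj m n x y → BookAdj m n y x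
bookAdj-sym (inj₁ (refl , inj₁ e)) = inj₁ (refl , inj₂ e)
bookAdj-sym (inj₁ (refl , inj₂ e)) = inj₁ (refl , inj₁ e)
bookAdj-sym (inj₂ (refl , inj₁ e)) = inj₂ (refl , inj₂ e)
bookAdj-sym (inj₂ (refl , inj₂ e)) = inj₂ (refl , inj₁ e)

columnWalkUp : ∀ {m n} (b : Fin m) t (i j : Fin n) → toℕ j ≡ t + toℕ i →
               Walk (BookAdj m n) (b , i) (b , j) t
columnWalkUp b zero    i j j≡i rewrite toℕ-injective j≡i = nil
columnWalkUp {m} {n} b (suc t) i j j≡t+1+i =
  cons (inj₁ (refl , inj₁ (sym (toℕ-fromℕ< i+1<n)))) (columnWalkUp b t (fromℕ< i+1<n) j j≡t+i')
  where
  j≡t+[i+1] : toℕ j ≡ t + suc (toℕ i)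
  j≡t+[i+1] = trans j≡t+1+i (sym (+-suc t (toℕ i)))
  i+1<n : suc (toℕ i) < n
  i+1<n = ≤-<-trans (≤-trans (m≤n+m (suc (toℕ i)) t) (≤-reflexive (sym j≡t+[i+1]))) (toℕ<n j)
  j≡t+i' : toℕ j ≡ t + toℕ (fromℕ< i+1<n)
  j≡t+i' = trans j≡t+[i+1] (cong (t +_) (sym (toℕ-fromℕ< i+1<n)))

columnWalk : ∀ {m n} (b : Fin m) (i j : Fin n) → Walk (BookAdj m n) (b , i) (b , j) ∣ toℕ i - toℕ j ∣
columnWalk {m} {n} b i j with ≤-total (toℕ i) (toℕ j)
... | inj₁ i≤j = subst (Walk (BookAdj m n) (b , i) (b , j)) (sym (m≤n⇒∣m-n∣≡n∸m i≤j))
                   (columnWalkUp b (toℕ j ∸ toℕ i) i j (sym (m∸n+n≡m i≤j)))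
... | inj₂ j≤i = subst (Walk (BookAdj m n) (b , i) (b , j)) (sym (m≤n⇒∣n-m∣≡n∸m j≤i))
                   (reverseʷ bookAdj-sym (columnWalkUp b (toℕ i ∸ toℕ j) j i (sym (m∸n+n≡m j≤i))))

depth : ∀ {m} → Fin m → ℕ
depth zero    = 0
depth (suc _) = 1

level : ∀ {m n} → ℕ → Vtx m n → ℕ
level c (a , i) = depth a + ∣ toℕ i - c ∣

walkToHub : ∀ {m n} (c : Fin n) (v : Vtx (suc m) n) →
            Walk (BookAdj (suc m) n) v (zero , c) (level (toℕ c) v)
walkToHub c (zero  , i) = columnWalk zero i c
walkToHub c (suc a , i) = cons (inj₂ (refl , inj₂ (refl , λ ()))) (columnWalk zero i c)

dist≤level+level : ∀ {m n c} → c < n → ∀ {u v : Vtx (suc m) n} {k} → IsDist (BookAdj (suc m) n) u v k →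
                   k ≤ level c u + level c v
dist≤level+level {c = c} c<n {u} {v} {k} (_ , shortest) =
  subst (λ c → k ≤ level c u + level c v) (toℕ-fromℕ< c<n)
        (shortest _ (walkToHub hub u ++ʷ reverseʷ bookAdj-sym (walkToHub hub v)))
  where
  hub = fromℕ< c<n

-- A step moves this potential by at most one (changing leaves costs two steps through the
-- centre), yet it differs by n + 1 between leaf 1 at the bottom and leaf 2 at the top.
tilt : ℕ → ℕ
tilt 1 = 0
tilt 2 = 2
tilt _ = 1

tilt≤2 : ∀ a → tilt a ≤ 2
tilt≤2 0                   = s≤s z≤n
tilt≤2 1                   = z≤n
tilt≤2 2                   = ≤-refl
tilt≤2 (suc (suc (suc _))) = s≤s z≤n

potential : ∀ {m n} → Vtx m n → ℕ
potential (a , i) = tilt (toℕ a) + toℕ i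

potential-step : ∀ {m n} {x y : Vtx m n} → BookAdj m n x y → potential y ≤ suc (potential x)
potential-step {x = a , i} (inj₁ (refl , inj₁ i+1≡j)) =
  ≤-reflexive (trans (cong (tilt (toℕ a) +_) (sym i+1≡j)) (+-suc _ _))
potential-step {x = a , i} (inj₁ (refl , inj₂ j+1≡i)) =
  ≤-trans (+-monoʳ-≤ (tilt (toℕ a)) (≤-trans (n≤1+n _) (≤-reflexive j+1≡i))) (n≤1+n _)
potential-step {x = a , i} {b , _} (inj₂ (refl , inj₁ (a≡0 , _))) =
  +-monoˡ-≤ (toℕ i) (≤-trans (tilt≤2 (toℕ b)) (≤-reflexive (cong (suc ∘ tilt) (sym a≡0))))
potential-step {x = a , i} (inj₂ (refl , inj₂ (b≡0 , _))) =
  +-monoˡ-≤ (toℕ i) (≤-trans (≤-reflexive (cong tilt b≡0)) (s≤s z≤n))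

diam-lower : ∀ {m n} D → 3 ≤ m → IsDiam (BookAdj m (suc n)) D → suc (suc n) ≤ D
diam-lower {n = n} D (s≤s (s≤s (s≤s _))) (dists , _)
  with dists (suc zero , zero) (suc (suc zero) , fromℕ n)
... | k , (w , _) , k≤D = begin
  suc (suc n)           ≡⟨ cong (λ t → suc (suc t)) (toℕ-fromℕ n) ⟨
  2 + toℕ (fromℕ n)     ≤⟨ walk-potential potential potential-step w ⟩
  k                     ≤⟨ k≤D ⟩
  D                     ∎
  where open ≤-Reasoning

sum-level : ∀ m n c → let P = sum (applyUpTo (λ i → ∣ i - c ∣) n) in
            sum (map (level c) (vertices (suc m) n)) ≡ P + m * (n + P)
sum-level m n c = begin
  sum (map (level c) (vertices (suc m) n))
    ≡⟨ sum-map-cartesianProduct (level c) (allFin (suc m)) (allFin n) ⟩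
  sum (map column (allFin (suc m)))
    ≡⟨ cong sum (map-allFin-suc column) ⟩
  column zero + sum (map (column ∘ suc) (allFin m))
    ≡⟨ cong (column zero +_) (cong sum (map-cong column-leaf (allFin m))) ⟩
  column zero + sum (map (λ _ → n + P) (allFin m))
    ≡⟨ cong₂ _+_ column-hub (sum-map-const (n + P) (allFin m)) ⟩
  P + length (allFin m) * (n + P)
    ≡⟨ cong (λ l → P + l * (n + P)) (length-allFin m) ⟩
  P + m * (n + P) ∎
  where
  open ≡-Reasoning
  P : ℕ
  P = sum (applyUpTo (λ i → ∣ i - c ∣) n)
  column : Fin (suc m) → ℕ
  column a = sum (map (λ i → level c (a , i)) (allFin n))
  column-hub : column zero ≡ P
  column-hub = sum-map-allFin-toℕ (λ i → ∣ i - c ∣) n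
  column-leaf : ∀ a → column (suc a) ≡ n + P
  column-leaf a = trans (sum-map-suc (λ i → ∣ toℕ i - c ∣) (allFin n)) (cong₂ _+_ (length-allFin n) column-hub)

sum-level-centred : ∀ m k → sum (map (level k) (vertices (suc m) (suc (k * 2)))) ≡
                            k * suc k + m * (suc (k * 2) + k * suc k)
sum-level-centred m k =
  trans (sum-level m (suc (k * 2)) k) (cong (λ P → P + m * (suc (k * 2) + P)) (sum-∣i-k∣-below-2k+1 k))

length-vertices : ∀ m n → length (vertices m n) ≡ m * n
length-vertices m n =
  trans (length-cartesianProduct (allFin m) (allFin n)) (cong₂ _*_ (length-allFin m) (length-allFin n))

unique-vertices : ∀ m n → Unique (vertices m n)
unique-vertices m n = cartesianProduct⁺ (allFin⁺ m) (allFin⁺ n)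

radio-arithmetic : ∀ m′ k D s → suc (suc (k * 2)) ≤ D →
  (k * 2 + m′ * suc (k * 2)) * suc D ≤ s + 2 * (k * suc k + m′ * (suc (k * 2) + k * suc k)) →
  suc m′ * suc (k * 2) * suc (k * 2) + suc m′ + 2 * suc (k * 2) ∸ 4 ≤ 2 * s
radio-arithmetic m′ k D s n+1≤D chain = begin
  suc m′ * n * n + suc m′ + 2 * n ∸ 4  ≡⟨ cong (_∸ 4) (lhs≡4+R m′ k) ⟩
  4 + R ∸ 4                            ≡⟨ m+n∸m≡n 4 R ⟩
  R                                    ≤⟨ +-cancelʳ-≤ (4 * Σ) R (2 * s) (begin
    R + 4 * Σ                            ≡⟨ R+4Σ≡2N[n+2] m′ k ⟩
    2 * (N * (2 + n))                    ≤⟨ *-monoʳ-≤ 2 (*-monoʳ-≤ N (s≤s n+1≤D)) ⟩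
    2 * (N * suc D)                      ≤⟨ *-monoʳ-≤ 2 chain ⟩
    2 * (s + 2 * Σ)                      ≡⟨ *-distribˡ-+ 2 s (2 * Σ) ⟩
    2 * s + 2 * (2 * Σ)                  ≡⟨ cong (2 * s +_) (*-assoc 2 2 Σ) ⟨
    2 * s + 4 * Σ                        ∎) ⟩
  2 * s                                ∎
  where
  open ≤-Reasoning
  n N Σ R : ℕ
  n = suc (k * 2)
  N = k * 2 + m′ * n
  Σ = k * suc k + m′ * (n + k * suc k)
  R = m′ * n * n + 4 * k * k + 8 * k + m′
  lhs≡4+R : ∀ m′ k → suc m′ * suc (k * 2) * suc (k * 2) + suc m′ + 2 * suc (k * 2) ≡
                     4 + (m′ * suc (k * 2) * suc (k * 2) + 4 * k * k + 8 * k + m′)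
  lhs≡4+R = solve-∀
  R+4Σ≡2N[n+2] : ∀ m′ k → (m′ * suc (k * 2) * suc (k * 2) + 4 * k * k + 8 * k + m′) +
                          4 * (k * suc k + m′ * (suc (k * 2) + k * suc k)) ≡
                          2 * ((k * 2 + m′ * suc (k * 2)) * (2 + suc (k * 2)))
  R+4Σ≡2N[n+2] = solve-∀

odd⇒≡2k+1 : ∀ n → n % 2 ≡ 1 → n ≡ suc (n / 2 * 2)
odd⇒≡2k+1 n n%2≡1 = trans (m≡m%n+[m/n]*n n 2) (cong (_+ n / 2 * 2) n%2≡1)

lemma5 : ∀ (m n : ℕ) → 4 ≤ m → 5 ≤ n → n % 2 ≡ 1 →
         ∀ (D : ℕ) → IsDiam (BookAdj m n) D →
         ∀ (f : Vtx m n → ℕ) → IsRadio (BookAdj m n) D f →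
         m * n * n + m + 2 * n ∸ 4 ≤ 2 * span m n f
lemma5 m@(suc m′) n 4≤m _ n%2≡1 D diam f radio with n / 2 | odd⇒≡2k+1 n n%2≡1
... | k | refl = radio-arithmetic m′ k D (span m n f) (diam-lower D (≤-trans (n≤1+n 3) 4≤m) diam) (begin
  (k * 2 + m′ * n) * suc D                  ≡⟨ cong (λ l → (l ∸ 1) * suc D) (length-vertices m n) ⟨
  (length (vertices m n) ∸ 1) * suc D       ≤⟨ gap-spread f L gap (maxLabel m n f) (vertices m n) (unique-vertices m n) ⟩
  span m n f + 2 * sum (map L (vertices m n)) ≡⟨ cong (λ t → span m n f + 2 * t) (sum-level-centred m′ k) ⟩
  span m n f + 2 * (k * suc k + m′ * (n + k * suc k)) ∎)
  where
  open ≤-Reasoning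
  L : Vtx m n → ℕ
  L = level k
  gap : Gap f L (suc D)
  gap = radio-gap L diam (dist≤level+level (s≤s (m≤m*n k 2))) radio
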